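{- There is a map $\Psi$ with the following property. For every $2$-vertex-connected graph $H$ on $n$ vertices, the deck of $H$ equals $\Psi$ applied to the $(n-1)$-graphlet degree distribution of $H$. In other words, the $(n-1)$-gdd of a $2$-vertex-connected graph determines its deck.
   Context: All graphs are finite, simple and undirected. The deck of a graph $H$ is the multiset $\{H-v : v\in V(H)\}$ of isomorphism classes of its vertex-deleted subgraphs. A graphlet is a pair $(G,r)$ with $G$ a connected graph with at least one and fewer than $n$ vertices and $r\in V(G)$. Two graphlets are isomorphic if some isomorphism of the graphs maps root to root; graphlets are taken up to isomorphism in a fixed enumeration. For $v\in V(H)$, the graphlet degree of $v$ with respect to $(G,r)$ is the number of sets $S\subseteq V(H)$ with $v\in S$ such that some isomorphism $H[S]\to G$ maps $v$ to $r$. The $(n-1)$-graphlet degree distribution of $H$ is the matrix with rows indexed by the vertices of $H$ and columns by the graphlet classes with exactly $n-1$ vertices. Its entries are the graphlet degrees. -}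

module Defs where

open import Data.Nat using (ℕ; zero; suc; _≤_)
open import Data.Bool using (Bool; true; false; _∧_; _∨_; not; if_then_else_)
open import Data.Fin using (Fin; punchIn; _≟_)
open import Data.Fin.Permutation using (Permutation′; _⟨$⟩ʳ_)
open import Data.List using (List; []; _∷_; map; concatMap; filter; length; allFin)
open import Data.Bool.ListAction using (all; any)
open import Data.Vec using (Vec; lookup) renaming ([] to []ᵥ; _∷_ to _∷ᵥ_)
open import Data.Product using (Σ; ∃; _×_; _,_)
open import Relation.Nullary.Decidable using (⌊_⌋)
open import Data.Bool.Properties using (T?)
open import Relation.Binary.PropositionalEquality using (_≡_)

record Graph (n : ℕ) : Set where
  field
    adj    : Fin n → Fin n → Bool
    sym    : ∀ i j → adj i j ≡ adj j i
    irrefl : ∀ i → adj i i ≡ false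
open Graph public

data Reach {n : ℕ} (G : Graph n) : Fin n → Fin n → Set where
  here : ∀ {i} → Reach G i i
  step : ∀ {i j k} → adj G i j ≡ true → Reach G j k → Reach G i k

Connected : {n : ℕ} → Graph n → Set
Connected {n} G = ∀ (i j : Fin n) → Reach G i j

delete : {m : ℕ} → Graph (suc m) → Fin (suc m) → Graph m
delete H u = record
  { adj    = λ i j → adj H (punchIn u i) (punchIn u j)
  ; sym    = λ i j → sym H (punchIn u i) (punchIn u j)
  ; irrefl = λ i → irrefl H (punchIn u i) }

TwoConnected : {n : ℕ} → Graph n → Set
TwoConnected {zero} H = Data.Empty.⊥ where import Data.Empty
TwoConnected {suc m} H = (2 ≤ m) × Connected H × (∀ u → Connected (delete H u))

Iso : {k : ℕ} → Graph k → Graph k → Set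
Iso {k} G G' = Σ (Permutation′ k) λ σ →
  ∀ a b → adj G a b ≡ adj G' (σ ⟨$⟩ʳ a) (σ ⟨$⟩ʳ b)

Deck : ℕ → Set
Deck m = Fin (suc m) → Graph m

deck : {m : ℕ} → Graph (suc m) → Deck m
deck H u = delete H u

-- Equality of decks as multisets of isomorphism classes.
SameDeck : {m : ℕ} → Deck m → Deck m → Set
SameDeck {m} D D' = Σ (Permutation′ (suc m)) λ π → ∀ i → Iso (D i) (D' (π ⟨$⟩ʳ i))

record Graphlet (k : ℕ) : Set where
  field
    graph     : Graph k
    root      : Fin k
    connected : Connected graph
open Graphlet public

allVecs : {A : Set} → List A → (k : ℕ) → List (Vec A k)
allVecs xs zero    = []ᵥ ∷ []
allVecs xs (suc k) = concatMap (λ x → map (x ∷ᵥ_) (allVecs xs k)) xs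

allBool : List Bool
allBool = true ∷ false ∷ []

_==_ : {n : ℕ} → Fin n → Fin n → Bool
i == j = ⌊ i ≟ j ⌋

_⇔ᵇ_ : Bool → Bool → Bool
true  ⇔ᵇ b = b
false ⇔ᵇ b = not b

-- f : Fin k → Fin n (as a vector) is the inverse of an isomorphism
-- H[S] → G sending v to r: f is injective with image exactly S,
-- adjacency in G equals adjacency in H of the images, and f r = v.
isRootedIsoInv : {n k : ℕ} → Graph n → Fin n → Vec Bool n →
                 Graph k → Fin k → Vec (Fin n) k → Bool
isRootedIsoInv {n} {k} H v S G r f =
  all (λ a → all (λ b → (a == b) ∨ not (lookup f a == lookup f b)) (allFin k)) (allFin k)
  ∧ all (λ u → lookup S u ⇔ᵇ any (λ a → lookup f a == u) (allFin k)) (allFin n)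
  ∧ all (λ a → all (λ b → adj G a b ⇔ᵇ adj H (lookup f a) (lookup f b)) (allFin k)) (allFin k)
  ∧ (lookup f r == v)

-- Graphlet degree of v in H w.r.t. (G , r): the number of vertex sets
-- S ⊆ V(H) with v ∈ S such that some isomorphism H[S] → G maps v to r.
graphletDegree : {n k : ℕ} → Graph n → Fin n → Graphlet k → ℕ
graphletDegree {n} {k} H v g =
  length (filter (λ S → T? (lookup S v ∧ any (isRootedIsoInv H v S (graph g) (root g))
                                              (allVecs (allFin n) k)))
                 (allVecs allBool n))

-- The (n-1)-graphlet degree distribution of H on n = suc m vertices:
-- rows = vertices of H, columns = rooted connected graphs on m = n - 1
-- vertices (graphlet degree is invariant under graphlet isomorphism, so
-- this is the matrix indexed by graphlet classes).
GDD : ℕ → Set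
GDD m = Fin (suc m) → Graphlet m → ℕ

gdd : {m : ℕ} → Graph (suc m) → GDD m
gdd H v g = graphletDegree H v g

-- Let H have n = m + 1 vertices and let G be a connected m-vertex graph.  A set S
-- counted by the graphlet degree of x at (G , r) has m elements, so S = V(H) - u
-- for some u ≠ x with H - u ≅ G, and the roots r realised by such isomorphisms at
-- x form one orbit of Aut(G).  Summing the degrees of x over one root per orbit
-- therefore gives N(x), the number of u ≠ x with H - u ≅ G.  As N(x) + [H - x ≅ G]
-- does not depend on x, H - w ≅ G holds iff N(w) < N(y) for some y or N(y) = m for
-- all y (when m ≥ 1).  For 2-connected H every card is connected, i.e. a graphlet,
-- so testing all connected m-vertex graphs against this criterion recovers each
-- card H - w from the gdd.

module Submission where

open import Defs renaming (sym to adj-sym)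

open import Data.Bool using (Bool; true; false; T; not; _∧_; _∨_; if_then_else_)
open import Data.Bool.ListAction using (any; all)
open import Data.Bool.Properties using (T-≡; T-∧; T-∨; T?; ¬-not; ∧-zeroʳ; ∧-comm; ∧-idem)
open import Data.Empty using (⊥-elim)
open import Data.Fin using (Fin; zero; suc; punchIn; punchOut; _≟_) renaming (_<_ to _<ᶠ_)
open import Data.Fin.Induction using (<-wellFounded)
import Data.Fin.Permutation as Perm
import Data.Fin.Properties as Fin
open import Data.Fin.Subset using (Subset; _∈_; _⊆_; _⊂_; ∁; ⁅_⁆; ⊥; ⊤; ∣_∣)
open import Data.Fin.Subset.Properties
  using (_∈?_; _⊂?_; ⊆-antisym; ⊆-trans; ⊥⊆; ∉⊥; ∈⊤; ∣p∣≤n; p⊂q⇒∣p∣<∣q∣;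
         x∈∁p⇒x∉p; x∉p⇒x∈∁p; x∉⁅y⁆⇒x≢y; x≢y⇒x∉⁅y⁆)
open import Data.List using (List; []; _∷_; _++_; map; concatMap; length; filter; allFin)
open import Data.List.Membership.Propositional using (find; lose) renaming (_∈_ to _∈ˡ_)
open import Data.List.Membership.Propositional.Properties using (∈-allFin; ∈-map⁺; ∈-concat⁺′)
open import Data.List.Relation.Unary.Any using (Any; here; there)
import Data.List.Relation.Unary.Any as Any
open import Data.List.Relation.Unary.Any.Properties using (any⁺; any⁻)
import Data.List.Relation.Unary.All as All
open import Data.List.Relation.Unary.All.Properties using (all⁺; all⁻)
open import Data.Nat using (ℕ; zero; suc; _+_; _≤_; _<_; z≤n; s≤s)
import Data.Nat.Properties as ℕ
open import Data.Product using (Σ; ∃; _×_; _,_; proj₁; proj₂)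
open import Data.Sum using (_⊎_; inj₁; inj₂)
import Data.Sum as Sum
open import Data.Vec using (Vec; lookup; tabulate) renaming ([] to []ᵥ; _∷_ to _∷ᵥ_)
open import Data.Vec.Functional using (Vector; removeAt)
open import Data.Vec.Properties using (lookup⇒[]=; []=⇒lookup; ∷-injectiveˡ; ∷-injectiveʳ; lookup∘tabulate)
open import Function using (_∘_; _⇔_; mk⇔; Equivalence)
open import Function.Definitions using (Injective)
open import Function.Construct.Composition using (_⇔-∘_)
open import Relation.Binary.PropositionalEquality
  using (_≡_; _≢_; refl; sym; trans; cong; cong₂; subst; module ≡-Reasoning)
open import Relation.Nullary using (¬_; Dec; yes; no; does; ¬?)
open import Relation.Nullary.Decidable using (_×-dec_; _⊎-dec_; toWitness; fromWitness)
import Relation.Nullary.Decidable as Dec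
open import Relation.Nullary.Negation using (contradiction)
open import Relation.Binary.Definitions using (tri<; tri≈; tri>)
open import Induction.WellFounded using (Acc; acc)

open import Algebra.Properties.CommutativeMonoid.Sum ℕ.+-0-commutativeMonoid
  using (sum; sum-syntax; sum-cong-≗; sum-remove; sum-replicate-zero; ∑-comm)
open import Algebra.Properties.CommutativeSemigroup ℕ.+-commutativeSemigroup using (xy∙z≈zy∙x)

open Equivalence using (to; from)

private
  variable
    A : Set
    k m n : ℕ

𝟙 : Bool → ℕ
𝟙 true  = 1
𝟙 false = 0

𝟙-T : ∀ {b} → T b → 𝟙 b ≡ 1
𝟙-T {true} _ = refl

𝟙-¬T : ∀ {b} → ¬ T b → 𝟙 b ≡ 0
𝟙-¬T {true}  ¬t = contradiction _ ¬t
𝟙-¬T {false} _  = refl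

T-not : ∀ {b} → T (not b) ⇔ (¬ T b)
T-not {true}  = mk⇔ (λ ()) (λ ¬t → ¬t _)
T-not {false} = mk⇔ (λ _ ()) (λ _ → _)

T-injective : ∀ {a b} → (T a ⇔ T b) → a ≡ b
T-injective {true}  {true}  _ = refl
T-injective {true}  {false} e = ⊥-elim (to e _)
T-injective {false} {true}  e = ⊥-elim (from e _)
T-injective {false} {false} _ = refl

T-⇔ᵇ : ∀ {a b} → T (a ⇔ᵇ b) ⇔ (a ≡ b)
T-⇔ᵇ {true}  {true}  = mk⇔ (λ _ → refl) (λ _ → _)
T-⇔ᵇ {true}  {false} = mk⇔ (λ ()) (λ ())
T-⇔ᵇ {false} {true}  = mk⇔ (λ ()) (λ ())
T-⇔ᵇ {false} {false} = mk⇔ (λ _ → refl) (λ _ → _)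

T-== : {i j : Fin n} → T (i == j) ⇔ (i ≡ j)
T-== = mk⇔ toWitness fromWitness

==-refl : (i : Fin n) → (i == i) ≡ true
==-refl i = to T-≡ (from T-== refl)

==-sym : (i j : Fin n) → (i == j) ≡ (j == i)
==-sym i j with i ≟ j | j ≟ i
... | yes _   | yes _   = refl
... | no _    | no _    = refl
... | yes i≡j | no j≢i  = contradiction (sym i≡j) j≢i
... | no i≢j  | yes j≡i = contradiction (sym j≡i) i≢j

T-lookup : {S : Subset n} {x : Fin n} → T (lookup S x) ⇔ (x ∈ S)
T-lookup {S = S} {x} = mk⇔ (λ t → lookup⇒[]= x S (to T-≡ t)) (λ x∈S → from T-≡ ([]=⇒lookup x∈S))

∈∁⁅⁆ : {x u : Fin n} → x ∈ ∁ ⁅ u ⁆ ⇔ (x ≢ u)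
∈∁⁅⁆ = mk⇔ (x∉⁅y⁆⇒x≢y ∘ x∈∁p⇒x∉p) (x∉p⇒x∈∁p ∘ x≢y⇒x∉⁅y⁆)

lookup-∁⁅⁆ : {x u : Fin n} → x ≢ u → lookup (∁ ⁅ u ⁆) x ≡ true
lookup-∁⁅⁆ x≢u = to T-≡ (from T-lookup (from ∈∁⁅⁆ x≢u))

lookup-∁⁅⁆-self : (u : Fin n) → lookup (∁ ⁅ u ⁆) u ≡ false
lookup-∁⁅⁆-self u = ¬-not λ eq → to ∈∁⁅⁆ (to (T-lookup {S = ∁ ⁅ u ⁆}) (from T-≡ eq)) refl

Exhaustive : List A → Set
Exhaustive xs = ∀ x → x ∈ˡ xs

T-any : {p : A → Bool} {xs : List A} → Exhaustive xs → T (any p xs) ⇔ ∃ (T ∘ p)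
T-any {p = p} {xs} every = mk⇔ witness (λ (x , px) → any⁺ p (lose (every x) px))
  where
  witness : T (any p xs) → ∃ (T ∘ p)
  witness t with x , _ , px ← find (any⁻ p xs t) = x , px

T-all : {p : A → Bool} {xs : List A} → Exhaustive xs → T (all p xs) ⇔ (∀ x → T (p x))
T-all {p = p} {xs} every =
  mk⇔ (λ t x → All.lookup (all⁺ p xs t) (every x)) (λ h → all⁻ p {xs} (All.tabulate (λ {x} _ → h x)))

allBool-exhaustive : Exhaustive allBool
allBool-exhaustive true  = here refl
allBool-exhaustive false = there (here refl)

allVecs-exhaustive : {xs : List A} → Exhaustive xs → Exhaustive (allVecs xs k)
allVecs-exhaustive every []ᵥ       = here refl
allVecs-exhaustive every (x ∷ᵥ v) =
  ∈-concat⁺′ (∈-map⁺ (x ∷ᵥ_) (allVecs-exhaustive every v)) (∈-map⁺ _ (every x))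

T-any-allFin : {p : Fin n → Bool} → T (any p (allFin n)) ⇔ ∃ (T ∘ p)
T-any-allFin = T-any ∈-allFin

T-all-allFin : {p : Fin n → Bool} → T (all p (allFin n)) ⇔ (∀ i → T (p i))
T-all-allFin = T-all ∈-allFin

-- Finite sums and counting

sum-except : (f g : Vector ℕ (suc n)) (i : Fin (suc n)) → (∀ j → j ≢ i → f j ≡ g j) →
             sum f + g i ≡ sum g + f i
sum-except f g i f≡g = begin
  sum f + g i                     ≡⟨ cong (_+ g i) (sum-remove {i = i} f) ⟩
  f i + sum (removeAt f i) + g i  ≡⟨ cong (λ s → f i + s + g i) (sum-cong-≗ λ j → f≡g _ (Fin.punchInᵢ≢i i j)) ⟩
  f i + sum (removeAt g i) + g i  ≡⟨ xy∙z≈zy∙x (f i) _ (g i) ⟩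
  g i + sum (removeAt g i) + f i  ≡⟨ cong (_+ f i) (sum-remove {i = i} g) ⟨
  sum g + f i                     ∎
  where open ≡-Reasoning

sum-zeros : (f : Vector ℕ n) → (∀ i → f i ≡ 0) → sum f ≡ 0
sum-zeros {n} f f≡0 = trans (sum-cong-≗ f≡0) (sum-replicate-zero n)

sum-ones : (f : Vector ℕ n) → (∀ i → f i ≡ 1) → sum f ≡ n
sum-ones {zero}  f f≡1 = refl
sum-ones {suc n} f f≡1 = cong₂ _+_ (f≡1 zero) (sum-ones (f ∘ suc) (f≡1 ∘ suc))

sum-pointMass : (f : Vector ℕ n) (i : Fin n) → (∀ j → j ≢ i → f j ≡ 0) → sum f ≡ f i
sum-pointMass {suc n} f i f≡0 = ℕ.+-cancelʳ-≡ 0 _ _ (begin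
  sum f + 0               ≡⟨ sum-except f (λ _ → 0) i f≡0 ⟩
  ∑[ _ < suc n ] 0 + f i  ≡⟨ cong (_+ f i) (sum-replicate-zero (suc n)) ⟩
  f i                     ≡⟨ ℕ.+-identityʳ (f i) ⟨
  f i + 0                 ∎)
  where open ≡-Reasoning

count : (A → Bool) → List A → ℕ
count p []       = 0
count p (x ∷ xs) = 𝟙 (p x) + count p xs

length-filter : (p : A → Bool) (xs : List A) → length (filter (T? ∘ p) xs) ≡ count p xs
length-filter p []       = refl
length-filter p (x ∷ xs) with p x
... | true  = cong suc (length-filter p xs)
... | false = length-filter p xs

count-++ : (p : A → Bool) (xs ys : List A) → count p (xs ++ ys) ≡ count p xs + count p ys
count-++ p []       ys = refl
count-++ p (x ∷ xs) ys = trans (cong (𝟙 (p x) +_) (count-++ p xs ys)) (sym (ℕ.+-assoc (𝟙 (p x)) _ _))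

count-map : {B : Set} (p : B → Bool) (f : A → B) (xs : List A) → count p (map f xs) ≡ count (p ∘ f) xs
count-map p f []       = refl
count-map p f (x ∷ xs) = cong (𝟙 (p (f x)) +_) (count-map p f xs)

count-none : (p : A → Bool) (xs : List A) → (∀ x → ¬ T (p x)) → count p xs ≡ 0
count-none p []       _    = refl
count-none p (x ∷ xs) ¬px = cong₂ _+_ (𝟙-¬T (¬px x)) (count-none p xs ¬px)

allSubsets : (n : ℕ) → List (Subset n)
allSubsets = allVecs allBool

count-allSubsets : (P : Subset (suc n) → Bool) →
                   count P (allSubsets (suc n)) ≡
                   count (P ∘ (true ∷ᵥ_)) (allSubsets n) + count (P ∘ (false ∷ᵥ_)) (allSubsets n)
count-allSubsets {n} P = begin
  count P (map (true ∷ᵥ_) S ++ map (false ∷ᵥ_) S ++ [])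
    ≡⟨ count-++ P (map (true ∷ᵥ_) S) _ ⟩
  count P (map (true ∷ᵥ_) S) + count P (map (false ∷ᵥ_) S ++ [])
    ≡⟨ cong (count P (map (true ∷ᵥ_) S) +_)
            (trans (count-++ P (map (false ∷ᵥ_) S) []) (ℕ.+-identityʳ _)) ⟩
  count P (map (true ∷ᵥ_) S) + count P (map (false ∷ᵥ_) S)
    ≡⟨ cong₂ _+_ (count-map P (true ∷ᵥ_) S) (count-map P (false ∷ᵥ_) S) ⟩
  count (P ∘ (true ∷ᵥ_)) S + count (P ∘ (false ∷ᵥ_)) S
    ∎
  where
  open ≡-Reasoning
  S = allSubsets n

true≢false : true ≢ false
true≢false ()

count-single : (P : Subset n → Bool) (q : Subset n) → (∀ S → T (P S) → S ≡ q) →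
               count P (allSubsets n) ≡ 𝟙 (P q)
count-single P []ᵥ      _    = ℕ.+-identityʳ _
count-single P (true ∷ᵥ q) only = trans (count-allSubsets P) (trans
  (cong₂ _+_ (count-single (P ∘ (true ∷ᵥ_)) q λ S t → ∷-injectiveʳ (only _ t))
             (count-none (P ∘ (false ∷ᵥ_)) (allSubsets _)
                         λ S t → true≢false (sym (∷-injectiveˡ (only _ t)))))
  (ℕ.+-identityʳ _))
count-single P (false ∷ᵥ q) only = trans (count-allSubsets P)
  (cong₂ _+_ (count-none (P ∘ (true ∷ᵥ_)) (allSubsets _) λ S t → true≢false (∷-injectiveˡ (only _ t)))
             (count-single (P ∘ (false ∷ᵥ_)) q λ S t → ∷-injectiveʳ (only _ t)))

count-∁⁅⁆ : (P : Subset n → Bool) → (∀ S → T (P S) → ∃ λ u → S ≡ ∁ ⁅ u ⁆) →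
            count P (allSubsets n) ≡ ∑[ u < n ] 𝟙 (P (∁ ⁅ u ⁆))
count-∁⁅⁆ {zero} P support with P []ᵥ in eq
... | true with () ← proj₁ (support []ᵥ (from T-≡ eq))
... | false = refl
count-∁⁅⁆ {suc n} P support = begin
  count P (allSubsets (suc n))
    ≡⟨ count-allSubsets P ⟩
  count (P ∘ (true ∷ᵥ_)) (allSubsets n) + count (P ∘ (false ∷ᵥ_)) (allSubsets n)
    ≡⟨ cong₂ _+_ (count-∁⁅⁆ (P ∘ (true ∷ᵥ_)) inside)
                 (count-single (P ∘ (false ∷ᵥ_)) (∁ ⊥) outside) ⟩
  ∑[ u < n ] 𝟙 (P (∁ ⁅ suc u ⁆)) + 𝟙 (P (∁ ⁅ zero ⁆))
    ≡⟨ ℕ.+-comm (∑[ u < n ] 𝟙 (P (∁ ⁅ suc u ⁆))) _ ⟩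
  ∑[ u < suc n ] 𝟙 (P (∁ ⁅ u ⁆))
    ∎
  where
  open ≡-Reasoning
  inside : ∀ S → T (P (true ∷ᵥ S)) → ∃ λ u → S ≡ ∁ ⁅ u ⁆
  inside S t with support _ t
  ... | zero  , eq with () ← ∷-injectiveˡ eq
  ... | suc u , eq = u , ∷-injectiveʳ eq
  outside : ∀ S → T (P (false ∷ᵥ S)) → S ≡ ∁ ⊥
  outside S t with support _ t
  ... | zero  , eq = ∷-injectiveʳ eq
  ... | suc u , eq with () ← ∷-injectiveˡ eq

-- Injections between finite sets

module _ {u : Fin (suc n)} (f : Fin m → Fin (suc n)) (avoids : ∀ a → f a ≢ u) where

  squeeze : Fin m → Fin n
  squeeze a = punchOut (avoids a ∘ sym)

  punchIn-squeeze : ∀ a → punchIn u (squeeze a) ≡ f a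
  punchIn-squeeze a = Fin.punchIn-punchOut _

  squeeze-injective : Injective _≡_ _≡_ f → Injective _≡_ _≡_ squeeze
  squeeze-injective inj {a} {b} eq = inj (Fin.punchOut-injective (avoids a ∘ sym) (avoids b ∘ sym) eq)

no-injection-into-smaller : (f : Fin (suc n) → Fin n) → ¬ Injective _≡_ _≡_ f
no-injection-into-smaller {n} f inj with i , j , i<j , fi≡fj ← Fin.pigeonhole (ℕ.n<1+n n) f =
  Fin.<⇒≢ i<j (inj fi≡fj)

injective-endo-misses-nothing : {y : Fin m} (f : Fin m → Fin m) → Injective _≡_ _≡_ f →
                                ¬ (∀ a → f a ≢ y)
injective-endo-misses-nothing {suc m} f inj avoids =
  no-injection-into-smaller (squeeze f avoids) (squeeze-injective f avoids inj)

injection-misses-one : (f : Fin m → Fin (suc m)) → Injective _≡_ _≡_ f →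
                       ∃ λ u → (∀ a → f a ≢ u) × (∀ x → x ≢ u → ∃ λ a → f a ≡ x)
injection-misses-one f inj with Fin.all? (λ x → Fin.any? (λ a → f a Fin.≟ x))
... | yes onto = ⊥-elim (no-injection-into-smaller (proj₁ ∘ onto) preimage-injective)
  where
  preimage-injective : Injective _≡_ _≡_ (proj₁ ∘ onto)
  preimage-injective {x} {y} eq = trans (sym (proj₂ (onto x))) (trans (cong f eq) (proj₂ (onto y)))
... | no ¬onto with u , u-missed ← Fin.¬∀⟶∃¬ _ _ (λ x → Fin.any? (λ a → f a Fin.≟ x)) ¬onto =
  u , avoids , hits
  where
  avoids : ∀ a → f a ≢ u
  avoids a fa≡u = u-missed (a , fa≡u)
  hits : ∀ x → x ≢ u → ∃ λ a → f a ≡ x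
  hits x x≢u with Fin.any? (λ a → f a Fin.≟ x)
  ... | yes hit     = hit
  ... | no x-missed = ⊥-elim (injective-endo-misses-nothing (squeeze f avoids) (squeeze-injective f avoids inj)
          λ a eq → x-missed (a , trans (sym (punchIn-squeeze f avoids a))
                                        (trans (cong (punchIn u) eq) (Fin.punchIn-punchOut (x≢u ∘ sym)))))

-- Induced copies

record InducedCopy {n k : ℕ} (H : Graph n) (S : Subset n) (G : Graph k) (f : Fin k → Fin n) : Set where
  field
    injective : Injective _≡_ _≡_ f
    image     : ∀ u → u ∈ S ⇔ ∃ λ a → f a ≡ u
    adjacency : ∀ a b → adj G a b ≡ adj H (f a) (f b)

  into : ∀ a → f a ∈ S
  into a = from (image (f a)) (a , refl)

open InducedCopy

module _ {H : Graph n} {S : Subset n} {G : Graph k} where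

  InducedCopy-cong : {f g : Fin k → Fin n} → (∀ a → f a ≡ g a) → InducedCopy H S G f → InducedCopy H S G g
  InducedCopy-cong f≗g c = record
    { injective = λ eq → injective c (trans (f≗g _) (trans eq (sym (f≗g _))))
    ; image     = λ u → mk⇔
        (λ u∈S → let a , fa≡u = to (image c u) u∈S in a , trans (sym (f≗g a)) fa≡u)
        (λ (a , ga≡u) → from (image c u) (a , trans (f≗g a) ga≡u))
    ; adjacency = λ a b → trans (adjacency c a b) (cong₂ (adj H) (f≗g a) (f≗g b))
    }

  InducedCopy-∘ : {f : Fin k → Fin n} {σ : Fin k → Fin k} →
                  InducedCopy H S G f → InducedCopy G ⊤ G σ → InducedCopy H S G (f ∘ σ)
  InducedCopy-∘ {f} {σ} fc σc = record
    { injective = injective σc ∘ injective fc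
    ; image     = λ u → mk⇔ (preimage u) (λ (b , fσb≡u) → subst (_∈ S) fσb≡u (into fc (σ b)))
    ; adjacency = λ a b → trans (adjacency σc a b) (adjacency fc (σ a) (σ b))
    }
    where
    preimage : ∀ u → u ∈ S → ∃ λ b → f (σ b) ≡ u
    preimage u u∈S with a , fa≡u ← to (image fc u) u∈S with b , σb≡a ← to (image σc a) ∈⊤ =
      b , trans (cong f σb≡a) fa≡u

  InducedCopy-relative : {f g : Fin k → Fin n} → InducedCopy H S G f → InducedCopy H S G g →
                         ∃ λ σ → InducedCopy G ⊤ G σ × (∀ a → g (σ a) ≡ f a)
  InducedCopy-relative {f} {g} fc gc = σ , σc , g∘σ≗f
    where
    σ : Fin k → Fin k
    σ a = proj₁ (to (image gc (f a)) (into fc a))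
    g∘σ≗f : ∀ a → g (σ a) ≡ f a
    g∘σ≗f a = proj₂ (to (image gc (f a)) (into fc a))
    σc : InducedCopy G ⊤ G σ
    σc = record
      { injective = λ {a} {b} eq → injective fc (trans (sym (g∘σ≗f a)) (trans (cong g eq) (g∘σ≗f b)))
      ; image     = λ u → mk⇔ (λ _ → let a , fa≡gu = to (image fc (g u)) (into gc u) in
                                     a , injective gc (trans (g∘σ≗f a) fa≡gu))
                              (λ _ → ∈⊤)
      ; adjacency = λ a b → trans (adjacency fc a b) (trans (sym (cong₂ (adj H) (g∘σ≗f a) (g∘σ≗f b)))
                                                         (sym (adjacency gc (σ a) (σ b))))
      }

InducedCopy-∁⁅⁆ : {H : Graph (suc m)} {S : Subset (suc m)} {G : Graph m} {f : Fin m → Fin (suc m)} →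
                  InducedCopy H S G f → ∃ λ u → S ≡ ∁ ⁅ u ⁆
InducedCopy-∁⁅⁆ {S = S} {f = f} fc with u , avoids , hits ← injection-misses-one f (injective fc) =
  u , ⊆-antisym S⊆∁⁅u⁆ ∁⁅u⁆⊆S
  where
  S⊆∁⁅u⁆ : S ⊆ ∁ ⁅ u ⁆
  S⊆∁⁅u⁆ {x} x∈S = from ∈∁⁅⁆ λ x≡u →
    let a , fa≡x = to (image fc x) x∈S in avoids a (trans fa≡x x≡u)
  ∁⁅u⁆⊆S : ∁ ⁅ u ⁆ ⊆ S
  ∁⁅u⁆⊆S {x} x∈∁⁅u⁆ = from (image fc x) (hits x (to ∈∁⁅⁆ x∈∁⁅u⁆))

module _ (H : Graph n) (S : Subset n) (G : Graph k) (f : Vec (Fin n) k) where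

  injectiveᵇ : Bool
  injectiveᵇ = all (λ a → all (λ b → (a == b) ∨ not (lookup f a == lookup f b)) (allFin k)) (allFin k)

  imageᵇ : Bool
  imageᵇ = all (λ u → lookup S u ⇔ᵇ any (λ a → lookup f a == u) (allFin k)) (allFin n)

  adjacencyᵇ : Bool
  adjacencyᵇ = all (λ a → all (λ b → adj G a b ⇔ᵇ adj H (lookup f a) (lookup f b)) (allFin k)) (allFin k)

  copyᵇ : Bool
  copyᵇ = injectiveᵇ ∧ imageᵇ ∧ adjacencyᵇ

  T-injectiveᵇ : T injectiveᵇ ⇔ Injective _≡_ _≡_ (lookup f)
  T-injectiveᵇ = mk⇔
    (λ t {a} {b} eq → case-split (to T-∨ (to T-all-allFin (to T-all-allFin t a) b)) eq)
    (λ inj → from T-all-allFin λ a → from T-all-allFin λ b → from T-∨ (decide inj a b (a ≟ b)))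
    where
    case-split : ∀ {a b} → T (a == b) ⊎ T (not (lookup f a == lookup f b)) →
                 lookup f a ≡ lookup f b → a ≡ b
    case-split (inj₁ a==b) _  = to T-== a==b
    case-split (inj₂ fa≠fb) eq = contradiction (from T-== eq) (to T-not fa≠fb)
    decide : Injective _≡_ _≡_ (lookup f) → ∀ a b → Dec (a ≡ b) →
             T (a == b) ⊎ T (not (lookup f a == lookup f b))
    decide inj a b (yes a≡b) = inj₁ (from T-== a≡b)
    decide inj a b (no a≢b)  = inj₂ (from T-not (a≢b ∘ inj ∘ to T-==))

  T-imageᵇ : T imageᵇ ⇔ (∀ u → u ∈ S ⇔ ∃ λ a → lookup f a ≡ u)
  T-imageᵇ = mk⇔
    (λ t u → let S∋u≡hit = to T-⇔ᵇ (to T-all-allFin t u) in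
      mk⇔ (to T-hit ∘ subst T S∋u≡hit ∘ from T-lookup)
          (to T-lookup ∘ subst T (sym S∋u≡hit) ∘ from T-hit))
    (λ img → from T-all-allFin λ u → from T-⇔ᵇ (T-injective
      (mk⇔ (from T-hit ∘ to (img u) ∘ to T-lookup) (from T-lookup ∘ from (img u) ∘ to T-hit))))
    where
    T-hit : ∀ {u} → T (any (λ a → lookup f a == u) (allFin k)) ⇔ ∃ λ a → lookup f a ≡ u
    T-hit = mk⇔ (λ t → let a , t′ = to T-any-allFin t in a , to T-== t′)
                (λ (a , fa≡u) → from T-any-allFin (a , from T-== fa≡u))

  T-adjacencyᵇ : T adjacencyᵇ ⇔ (∀ a b → adj G a b ≡ adj H (lookup f a) (lookup f b))
  T-adjacencyᵇ = mk⇔ (λ t a b → to T-⇔ᵇ (to T-all-allFin (to T-all-allFin t a) b))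
                     (λ h → from T-all-allFin λ a → from T-all-allFin λ b → from T-⇔ᵇ (h a b))

  T-copyᵇ : T copyᵇ ⇔ InducedCopy H S G (lookup f)
  T-copyᵇ = mk⇔
    (λ t → let i , t′ = to (T-∧ {injectiveᵇ}) t; im , ad = to (T-∧ {imageᵇ}) t′ in record
      { injective = to T-injectiveᵇ i ; image = to T-imageᵇ im ; adjacency = to T-adjacencyᵇ ad })
    (λ c → from T-∧ (from T-injectiveᵇ (injective c) ,
                     from T-∧ (from T-imageᵇ (image c) , from T-adjacencyᵇ (adjacency c))))

  T-isRootedIsoInv : ∀ {v r} → T (isRootedIsoInv H v S G r f) ⇔ (InducedCopy H S G (lookup f) × lookup f r ≡ v)
  T-isRootedIsoInv {v} {r} = mk⇔
    (λ t → let i , t₁ = to (T-∧ {injectiveᵇ}) t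
               im , t₂ = to (T-∧ {imageᵇ}) t₁
               ad , fr==v = to (T-∧ {adjacencyᵇ}) t₂
           in to T-copyᵇ (from T-∧ (i , from T-∧ (im , ad))) , to T-== fr==v)
    (λ (c , fr≡v) → let i , t₁ = to (T-∧ {injectiveᵇ}) (from T-copyᵇ c)
                        im , ad = to (T-∧ {imageᵇ}) t₁
                    in from T-∧ (i , from T-∧ (im , from T-∧ (ad , from (T-== {i = lookup f r}) fr≡v))))

hasRootedCopyᵇ : Graph n → Fin n → Subset n → Graph k → Fin k → Bool
hasRootedCopyᵇ {n} {k} H v S G r = any (isRootedIsoInv H v S G r) (allVecs (allFin n) k)

hasCopyᵇ : Graph n → Subset n → Graph k → Bool
hasCopyᵇ {n} {k} H S G = any (copyᵇ H S G) (allVecs (allFin n) k)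

RootedCopy : Graph n → Fin n → Subset n → Graph k → Fin k → Set
RootedCopy H v S G r = ∃ λ f → InducedCopy H S G f × f r ≡ v

module _ {H : Graph n} {S : Subset n} {G : Graph k} where

  private
    maps-exhaustive : Exhaustive (allVecs (allFin n) k)
    maps-exhaustive = allVecs-exhaustive ∈-allFin

  T-hasRootedCopy : ∀ {v r} → T (hasRootedCopyᵇ H v S G r) ⇔ RootedCopy H v S G r
  T-hasRootedCopy {v} {r} = mk⇔
    (λ t → let f , t′ = to (T-any maps-exhaustive) t in lookup f , to (T-isRootedIsoInv H S G f) t′)
    (λ (f , c , fr≡v) → from (T-any maps-exhaustive) (tabulate f , from (T-isRootedIsoInv H S G (tabulate f))
      (InducedCopy-cong (sym ∘ lookup∘tabulate f) c , trans (lookup∘tabulate f r) fr≡v)))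

  T-hasCopy : T (hasCopyᵇ H S G) ⇔ ∃ (InducedCopy H S G)
  T-hasCopy = mk⇔
    (λ t → let f , t′ = to (T-any maps-exhaustive) t in lookup f , to (T-copyᵇ H S G f) t′)
    (λ (f , c) → from (T-any maps-exhaustive)
      (tabulate f , from (T-copyᵇ H S G (tabulate f)) (InducedCopy-cong (sym ∘ lookup∘tabulate f) c)))

graphletDegree-∑ : (H : Graph (suc m)) (w : Fin (suc m)) (g : Graphlet m) →
  graphletDegree H w g ≡
  ∑[ u < suc m ] 𝟙 (lookup (∁ ⁅ u ⁆) w ∧ hasRootedCopyᵇ H w (∁ ⁅ u ⁆) (graph g) (root g))
graphletDegree-∑ H w g = trans (length-filter P (allSubsets _)) (count-∁⁅⁆ P support)
  where
  P : Subset _ → Bool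
  P S = lookup S w ∧ hasRootedCopyᵇ H w S (graph g) (root g)
  support : ∀ S → T (P S) → ∃ λ u → S ≡ ∁ ⁅ u ⁆
  support S t =
    let _ , c , _ = to (T-hasRootedCopy {H = H} {S} {graph g}) (proj₂ (to (T-∧ {lookup S w}) t))
    in InducedCopy-∁⁅⁆ c

-- Canonical roots

Automorphic : Graph k → Fin k → Fin k → Set
Automorphic G a b = RootedCopy G b ⊤ G a

Canonical : Graph k → Fin k → Set
Canonical G r = ¬ (∃ λ r′ → r′ <ᶠ r × Automorphic G r′ r)

-- Opaque, so that with-abstraction over canonical? G r finds it in goals, and the
-- type checker does not unfold the enumeration of maps behind it.
opaque
  automorphic? : (G : Graph k) (a b : Fin k) → Dec (Automorphic G a b)
  automorphic? G a b = Dec.map T-hasRootedCopy (T? (hasRootedCopyᵇ G b ⊤ G a))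

  smaller-automorphic? : (G : Graph k) (r : Fin k) → Dec (∃ λ r′ → r′ <ᶠ r × Automorphic G r′ r)
  smaller-automorphic? G r = Fin.any? (λ r′ → r′ Fin.<? r ×-dec automorphic? G r′ r)

  canonical? : (G : Graph k) (r : Fin k) → Dec (Canonical G r)
  canonical? G r = ¬? (smaller-automorphic? G r)

module _ {H : Graph n} {x : Fin n} {S : Subset n} {G : Graph k} where

  rootedCopies-automorphic : ∀ {r r′} → RootedCopy H x S G r → RootedCopy H x S G r′ → Automorphic G r r′
  rootedCopies-automorphic {r} (f , fc , fr≡x) (g , gc , gr′≡x)
    with σ , σc , g∘σ≗f ← InducedCopy-relative fc gc =
    σ , σc , injective gc (trans (g∘σ≗f r) (trans fr≡x (sym gr′≡x)))

  automorphic-rootedCopy : ∀ {r r′} → Automorphic G r′ r → RootedCopy H x S G r → RootedCopy H x S G r′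
  automorphic-rootedCopy (σ , σc , σr′≡r) (g , gc , gr≡x) =
    g ∘ σ , InducedCopy-∘ gc σc , trans (cong g σr′≡r) gr≡x

  canonical-rootedCopy : ∀ r → Acc _<ᶠ_ r → RootedCopy H x S G r →
                         ∃ λ c → Canonical G c × RootedCopy H x S G c
  canonical-rootedCopy r (acc smaller) rc with smaller-automorphic? G r
  ... | yes (r′ , r′<r , aut) = canonical-rootedCopy r′ (smaller r′<r) (automorphic-rootedCopy aut rc)
  ... | no none               = r , none , rc

  canonical-unique : ∀ {r r′} → Canonical G r → Canonical G r′ →
                     RootedCopy H x S G r → RootedCopy H x S G r′ → r ≡ r′
  canonical-unique {r} {r′} can can′ rc rc′ with Fin.<-cmp r r′
  ... | tri< r<r′ _ _ = contradiction (r , r<r′ , rootedCopies-automorphic rc rc′) can′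
  ... | tri≈ _ r≡r′ _ = r≡r′
  ... | tri> _ _ r′<r = contradiction (r′ , r′<r , rootedCopies-automorphic rc′ rc) can

  private
    canonicalRootedCount : Fin k → ℕ
    canonicalRootedCount r = 𝟙 (does (canonical? G r) ∧ hasRootedCopyᵇ H x S G r)

    canonicalRootedCount-none : ¬ ∃ (InducedCopy H S G) → ∀ r → canonicalRootedCount r ≡ 0
    canonicalRootedCount-none no-copy r with does (canonical? G r)
    ... | true  = 𝟙-¬T λ t → let f , fc , _ = to T-hasRootedCopy t in no-copy (f , fc)
    ... | false = refl

    ∑-canonicalRootedCount-copy : x ∈ S → ∃ (InducedCopy H S G) → ∑[ r < k ] canonicalRootedCount r ≡ 1
    ∑-canonicalRootedCount-copy x∈S (f , fc)
      with r₀ , fr₀≡x ← to (image fc x) x∈S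
      with c , can , rc ← canonical-rootedCopy r₀ (<-wellFounded r₀) (f , fc , fr₀≡x) =
      trans (sum-pointMass _ c others) at-c
      where
      at-c : canonicalRootedCount c ≡ 1
      at-c with canonical? G c
      ... | yes _   = 𝟙-T (from T-hasRootedCopy rc)
      ... | no ¬can = contradiction can ¬can
      others : ∀ r → r ≢ c → canonicalRootedCount r ≡ 0
      others r r≢c with canonical? G r
      ... | yes can′ = 𝟙-¬T λ t → r≢c (canonical-unique can′ can (to T-hasRootedCopy t) rc)
      ... | no _     = refl

  ∑-canonical-rootedCopies : x ∈ S →
    ∑[ r < k ] 𝟙 (does (canonical? G r) ∧ hasRootedCopyᵇ H x S G r) ≡ 𝟙 (hasCopyᵇ H S G)
  ∑-canonical-rootedCopies x∈S with T? (hasCopyᵇ H S G)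
  ... | yes copy = trans (∑-canonicalRootedCount-copy x∈S (to T-hasCopy copy)) (sym (𝟙-T copy))
  ... | no ¬copy = trans (sum-zeros _ (canonicalRootedCount-none (¬copy ∘ from T-hasCopy))) (sym (𝟙-¬T ¬copy))

-- Cards from graphlet degrees

ConnectedGraph : ℕ → Set
ConnectedGraph m = Σ (Graph m) Connected

rooted : ConnectedGraph m → Fin m → Graphlet m
rooted (G , c) r = record { graph = G ; root = r ; connected = c }

isCardᵇ : Graph (suc m) → Graph m → Fin (suc m) → Bool
isCardᵇ H G u = hasCopyᵇ H (∁ ⁅ u ⁆) G

-- For D = gdd H this is the number of vertices u ≠ x with H - u ≅ C (cardsAvoiding-gdd).
cardsAvoiding : GDD m → ConnectedGraph m → Fin (suc m) → ℕ
cardsAvoiding {m} D C x = ∑[ r < m ] (if does (canonical? (proj₁ C) r) then D x (rooted C r) else 0)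

cardsAvoiding-gdd : (H : Graph (suc m)) (C : ConnectedGraph m) (x : Fin (suc m)) →
  cardsAvoiding (gdd H) C x + 𝟙 (isCardᵇ H (proj₁ C) x) ≡ ∑[ u < suc m ] 𝟙 (isCardᵇ H (proj₁ C) u)
cardsAvoiding-gdd {m} H C x = begin
  cardsAvoiding (gdd H) C x + I x      ≡⟨ cong (_+ I x) (trans (sum-cong-≗ expand) (∑-comm term)) ⟩
  ∑[ u < suc m ] g u + I x             ≡⟨ sum-except g I x g≗I ⟩
  ∑[ u < suc m ] I u + g x             ≡⟨ cong (∑[ u < suc m ] I u +_) g-x≡0 ⟩
  ∑[ u < suc m ] I u + 0               ≡⟨ ℕ.+-identityʳ _ ⟩
  ∑[ u < suc m ] I u                   ∎
  where
  open ≡-Reasoning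
  G = proj₁ C
  I : Fin (suc m) → ℕ
  I u = 𝟙 (isCardᵇ H G u)
  term : Fin m → Fin (suc m) → ℕ
  term r u = 𝟙 (does (canonical? G r) ∧ (lookup (∁ ⁅ u ⁆) x ∧ hasRootedCopyᵇ H x (∁ ⁅ u ⁆) G r))
  g : Fin (suc m) → ℕ
  g u = ∑[ r < m ] term r u
  expand : ∀ r → (if does (canonical? G r) then gdd H x (rooted C r) else 0) ≡ ∑[ u < suc m ] term r u
  expand r with does (canonical? G r)
  ... | true  = graphletDegree-∑ H x (rooted C r)
  ... | false = sym (sum-replicate-zero (suc m))
  g≗I : ∀ u → u ≢ x → g u ≡ I u
  g≗I u u≢x = trans
    (sum-cong-≗ λ r → cong (λ b → 𝟙 (does (canonical? G r) ∧ (b ∧ hasRootedCopyᵇ H x (∁ ⁅ u ⁆) G r)))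
                           (lookup-∁⁅⁆ (u≢x ∘ sym)))
    (∑-canonical-rootedCopies {H = H} {G = G} (from ∈∁⁅⁆ (u≢x ∘ sym)))
  g-x≡0 : g x ≡ 0
  g-x≡0 = sum-zeros _ λ r → trans
    (cong (λ b → 𝟙 (does (canonical? G r) ∧ (b ∧ hasRootedCopyᵇ H x (∁ ⁅ x ⁆) G r))) (lookup-∁⁅⁆-self x))
    (cong 𝟙 (∧-zeroʳ (does (canonical? G r))))

indicator-from-complement-counts : (I : Fin (suc m) → Bool) (N : Fin (suc m) → ℕ) → 1 ≤ m →
  (∀ x → N x + 𝟙 (I x) ≡ ∑[ u < suc m ] 𝟙 (I u)) → (w : Fin (suc m)) →
  ((∃ λ y → N w < N y) ⊎ (∀ y → N y ≡ m)) ⇔ T (I w)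
indicator-from-complement-counts {m} I N 1≤m N+I≡c w = mk⇔ forward backward
  where
  c : ℕ
  c = ∑[ u < suc m ] 𝟙 (I u)

  forward : (∃ λ y → N w < N y) ⊎ (∀ y → N y ≡ m) → T (I w)
  forward crit with T? (I w)
  ... | yes Iw = Iw
  ... | no ¬Iw = ⊥-elim (impossible crit)
    where
    Nw≡c : N w ≡ c
    Nw≡c = trans (sym (ℕ.+-identityʳ (N w))) (trans (cong (N w +_) (sym (𝟙-¬T ¬Iw))) (N+I≡c w))
    impossible : ¬ ((∃ λ y → N w < N y) ⊎ (∀ y → N y ≡ m))
    impossible (inj₁ (y , Nw<Ny)) =
      ℕ.<⇒≱ Nw<Ny (subst (N y ≤_) (trans (N+I≡c y) (sym Nw≡c)) (ℕ.m≤m+n (N y) _))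
    impossible (inj₂ N≡m) = ℕ.<⇒≢ 1≤m (sym m≡0)
      where
      c≡m : c ≡ m
      c≡m = trans (sym Nw≡c) (N≡m w)
      no-cards : ∀ y → 𝟙 (I y) ≡ 0
      no-cards y = ℕ.+-cancelˡ-≡ (N y) _ _
        (trans (N+I≡c y) (trans c≡m (trans (sym (N≡m y)) (sym (ℕ.+-identityʳ (N y))))))
      m≡0 : m ≡ 0
      m≡0 = trans (sym c≡m) (sum-zeros _ no-cards)

  backward : T (I w) → (∃ λ y → N w < N y) ⊎ (∀ y → N y ≡ m)
  backward Iw with Fin.all? (T? ∘ I)
  ... | yes all-cards = inj₂ λ y → ℕ.suc-injective (begin
    suc (N y)        ≡⟨ ℕ.+-comm 1 (N y) ⟩
    N y + 1          ≡⟨ cong (N y +_) (𝟙-T (all-cards y)) ⟨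
    N y + 𝟙 (I y)    ≡⟨ N+I≡c y ⟩
    c                ≡⟨ sum-ones _ (𝟙-T ∘ all-cards) ⟩
    suc m            ∎)
    where open ≡-Reasoning
  ... | no ¬all with y , ¬Iy ← Fin.¬∀⟶∃¬ _ _ (T? ∘ I) ¬all = inj₁ (y , ℕ.≤-reflexive (begin
    suc (N w)        ≡⟨ ℕ.+-comm 1 (N w) ⟩
    N w + 1          ≡⟨ cong (N w +_) (𝟙-T Iw) ⟨
    N w + 𝟙 (I w)    ≡⟨ N+I≡c w ⟩
    c                ≡⟨ N+I≡c y ⟨
    N y + 𝟙 (I y)    ≡⟨ cong (N y +_) (𝟙-¬T ¬Iy) ⟩
    N y + 0          ≡⟨ ℕ.+-identityʳ (N y) ⟩
    N y              ∎))
    where open ≡-Reasoning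

Selects : GDD m → Fin (suc m) → ConnectedGraph m → Set
Selects {m} D w C = (∃ λ y → cardsAvoiding D C w < cardsAvoiding D C y) ⊎ (∀ y → cardsAvoiding D C y ≡ m)

selects? : (D : GDD m) (w : Fin (suc m)) (C : ConnectedGraph m) → Dec (Selects D w C)
selects? D w C = Fin.any? (λ y → cardsAvoiding D C w ℕ.<? cardsAvoiding D C y)
          ⊎-dec Fin.all? (λ y → cardsAvoiding D C y ℕ.≟ _)

selects-gdd : 1 ≤ m → (H : Graph (suc m)) (w : Fin (suc m)) (C : ConnectedGraph m) →
              Selects (gdd H) w C ⇔ ∃ (InducedCopy H (∁ ⁅ w ⁆) (proj₁ C))
selects-gdd 1≤m H w C =
  T-hasCopy {H = H} {∁ ⁅ w ⁆} {proj₁ C} ⇔-∘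
  indicator-from-complement-counts (isCardᵇ H (proj₁ C)) (cardsAvoiding (gdd H) C) 1≤m (cardsAvoiding-gdd H C) w

-- Deciding connectivity

⊆∧⊄⇒≡ : {p q : Subset n} → p ⊆ q → ¬ (p ⊂ q) → p ≡ q
⊆∧⊄⇒≡ {p = p} {q} p⊆q p⊄q = ⊆-antisym p⊆q q⊆p
  where
  q⊆p : q ⊆ p
  q⊆p {x} x∈q with x ∈? p
  ... | yes x∈p = x∈p
  ... | no x∉p  = contradiction ((λ {_} → p⊆q) , x , x∈q , x∉p) p⊄q

module Saturation {n : ℕ} (F : Subset n → Subset n) (F-mono : ∀ {p q} → p ⊆ q → F p ⊆ F q) where

  approx : ℕ → Subset n
  approx zero    = ⊥
  approx (suc t) = F (approx t)

  approx-mono : ∀ {s t} → s ≤ t → approx s ⊆ approx t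
  approx-mono z≤n       = ⊥⊆
  approx-mono (s≤s s≤t) = F-mono (approx-mono s≤t)

  -- The sizes ∣ approx t ∣ grow strictly until the sequence stalls, and are bounded by n.
  approx-stalls : ∃ λ t → t ≤ n × approx (suc t) ≡ approx t
  approx-stalls = search n 0 (ℕ.+-identityʳ n) z≤n
    where
    search : ∀ k t → k + t ≡ n → t ≤ ∣ approx t ∣ → ∃ λ s → s ≤ n × approx (suc s) ≡ approx s
    search k t k+t≡n t≤∣t∣ = continue k k+t≡n (approx t ⊂? approx (suc t))
      where
      grown : approx t ⊂ approx (suc t) → t < ∣ approx (suc t) ∣
      grown growth = ℕ.≤-<-trans t≤∣t∣ (p⊂q⇒∣p∣<∣q∣ {p = approx t} {q = approx (suc t)} growth)
      continue : ∀ k → k + t ≡ n → Dec (approx t ⊂ approx (suc t)) → ∃ λ s → s ≤ n × approx (suc s) ≡ approx s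
      continue k k+t≡n (no ¬growth) =
        t , subst (t ≤_) k+t≡n (ℕ.m≤n+m t k) , sym (⊆∧⊄⇒≡ (approx-mono {t} (ℕ.n≤1+n t)) ¬growth)
      continue zero t≡n (yes growth) =
        contradiction (ℕ.≤-trans (grown growth) (∣p∣≤n (approx (suc t)))) (subst (λ z → ¬ t < z) t≡n (ℕ.n≮n t))
      continue (suc k) k+t≡n (yes growth) = search k (suc t) (trans (ℕ.+-suc k t) k+t≡n) (grown growth)

  approx-⊆-stall : ∀ {t} → approx (suc t) ≡ approx t → ∀ s → approx s ⊆ approx t
  approx-⊆-stall stall zero    = ⊥⊆
  approx-⊆-stall {t} stall (suc s) = subst (approx (suc s) ⊆_) stall (F-mono (approx-⊆-stall {t} stall s))

  approx-saturated : ∀ s → approx s ⊆ approx n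
  approx-saturated s with t , t≤n , stall ← approx-stalls =
    ⊆-trans (approx-⊆-stall {t} stall s) (approx-mono t≤n)

∈-tabulate : {f : Fin n → Bool} {i : Fin n} → i ∈ tabulate f ⇔ T (f i)
∈-tabulate {f = f} {i} = mk⇔ (subst T (lookup∘tabulate f i) ∘ from T-lookup)
                             (to T-lookup ∘ subst T (sym (lookup∘tabulate f i)))

module _ (G : Graph m) (j : Fin m) where

  extend : Subset m → Subset m
  extend X = tabulate λ i → (i == j) ∨ any (λ k → adj G i k ∧ lookup X k) (allFin m)

  ∈-extend : ∀ {X i} → i ∈ extend X ⇔ (i ≡ j ⊎ ∃ λ k → adj G i k ≡ true × k ∈ X)
  ∈-extend {X} {i} = mk⇔
    (Sum.map (to T-==) step-back ∘ to T-∨ ∘ to ∈-tabulate)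
    (from ∈-tabulate ∘ from T-∨ ∘ Sum.map (from T-==) λ (k , a , k∈X) →
      from T-any-allFin (k , from T-∧ (from T-≡ a , from T-lookup k∈X)))
    where
    step-back : T (any (λ k → adj G i k ∧ lookup X k) (allFin m)) → ∃ λ k → adj G i k ≡ true × k ∈ X
    step-back t with k , t′ ← to T-any-allFin t with a , k∈X ← to (T-∧ {adj G i k}) t′ =
      k , to T-≡ a , to T-lookup k∈X

  extend-mono : ∀ {p q} → p ⊆ q → extend p ⊆ extend q
  extend-mono p⊆q i∈ = from ∈-extend (Sum.map₂ (λ (k , a , k∈p) → k , a , p⊆q k∈p) (to ∈-extend i∈))

  open Saturation extend extend-mono

  approx-sound : ∀ t {i} → i ∈ approx t → Reach G i j
  approx-sound zero    i∈ = contradiction i∈ ∉⊥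
  approx-sound (suc t) i∈ with to (∈-extend {approx t}) i∈
  ... | inj₁ refl          = here
  ... | inj₂ (k , a , k∈) = step a (approx-sound t k∈)

  approx-complete : ∀ {i} → Reach G i j → ∃ λ t → i ∈ approx t
  approx-complete here = 1 , from (∈-extend {⊥}) (inj₁ refl)
  approx-complete (step a r) with t , k∈ ← approx-complete r =
    suc t , from (∈-extend {approx t}) (inj₂ (_ , a , k∈))

  reaches? : ∀ i → Dec (Reach G i j)
  reaches? i = Dec.map′ (approx-sound m) (λ r → let t , i∈ = approx-complete r in approx-saturated t i∈)
                        (i ∈? approx m)

connected? : (G : Graph m) → Dec (Connected G)
connected? G = Fin.all? λ i → Fin.all? λ j → reaches? G j i

-- Reading the deck off the gdd

emptyGraph : Graph m
emptyGraph = record { adj = λ _ _ → false ; sym = λ _ _ → refl ; irrefl = λ _ → refl }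

fromMatrix : Vec (Vec Bool m) m → Graph m
fromMatrix M = record
  { adj    = λ i j → not (i == j) ∧ (lookup (lookup M i) j ∧ lookup (lookup M j) i)
  ; sym    = λ i j → cong₂ _∧_ (cong not (==-sym i j)) (∧-comm (lookup (lookup M i) j) _)
  ; irrefl = λ i → cong (λ b → not b ∧ (lookup (lookup M i) i ∧ lookup (lookup M i) i)) (==-refl i)
  }

adjacencyMatrix : Graph m → Vec (Vec Bool m) m
adjacencyMatrix G = tabulate λ i → tabulate (adj G i)

fromMatrix-adjacencyMatrix : (G : Graph m) (i j : Fin m) → adj (fromMatrix (adjacencyMatrix G)) i j ≡ adj G i j
fromMatrix-adjacencyMatrix G i j = begin
  not (i == j) ∧ (lookup (lookup M i) j ∧ lookup (lookup M j) i)
    ≡⟨ cong₂ (λ a b → not (i == j) ∧ (a ∧ b)) (entry i j) (trans (entry j i) (adj-sym G j i)) ⟩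
  not (i == j) ∧ (adj G i j ∧ adj G i j)
    ≡⟨ cong (not (i == j) ∧_) (∧-idem (adj G i j)) ⟩
  not (i == j) ∧ adj G i j
    ≡⟨ off-diagonal ⟩
  adj G i j
    ∎
  where
  open ≡-Reasoning
  M = adjacencyMatrix G
  entry : ∀ i j → lookup (lookup M i) j ≡ adj G i j
  entry i j = trans (cong (λ row → lookup row j) (lookup∘tabulate _ i)) (lookup∘tabulate _ j)
  off-diagonal : not (i == j) ∧ adj G i j ≡ adj G i j
  off-diagonal with i ≟ j
  ... | yes refl = sym (irrefl G i)
  ... | no _     = refl

Reach-cong : {G G′ : Graph m} → (∀ a b → adj G a b ≡ adj G′ a b) →
             ∀ {i j} → Reach G i j → Reach G′ i j
Reach-cong G≡G′ here       = here
Reach-cong G≡G′ (step a r) = step (trans (sym (G≡G′ _ _)) a) (Reach-cong G≡G′ r)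

connectedOnly : (G : Graph m) → Dec (Connected G) → List (ConnectedGraph m)
connectedOnly G (yes c) = (G , c) ∷ []
connectedOnly G (no _)  = []

∈-connectedOnly : {G : Graph m} (d : Dec (Connected G)) → Connected G →
                  ∃ λ c → (G , c) ∈ˡ connectedOnly G d
∈-connectedOnly (yes c) _ = c , here refl
∈-connectedOnly (no ¬c) c = contradiction c ¬c

keepIfConnected : Vec (Vec Bool m) m → List (ConnectedGraph m)
keepIfConnected M = connectedOnly (fromMatrix M) (connected? (fromMatrix M))

candidates : (m : ℕ) → List (ConnectedGraph m)
candidates m = concatMap keepIfConnected (allVecs (allVecs allBool m) m)

candidates-complete : {G : Graph m} → Connected G →
                      ∃ λ C → C ∈ˡ candidates m × (∀ a b → adj (proj₁ C) a b ≡ adj G a b)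
candidates-complete {m} {G} c =
  let c′ , C∈ = ∈-connectedOnly (connected? G′) (λ i j → Reach-cong G≡G′ (c i j)) in
  (G′ , c′) ,
  ∈-concat⁺′ C∈ (∈-map⁺ keepIfConnected
                   (allVecs-exhaustive (allVecs-exhaustive allBool-exhaustive) (adjacencyMatrix G))) ,
  fromMatrix-adjacencyMatrix G
  where
  G′ : Graph m
  G′ = fromMatrix (adjacencyMatrix G)
  G≡G′ : ∀ a b → adj G a b ≡ adj G′ a b
  G≡G′ a b = sym (fromMatrix-adjacencyMatrix G a b)

module _ {H : Graph (suc m)} {w : Fin (suc m)} where

  delete-card : {G : Graph m} → (∀ a b → adj G a b ≡ adj (delete H w) a b) →
                InducedCopy H (∁ ⁅ w ⁆) G (punchIn w)
  delete-card G≡H-w = record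
    { injective = Fin.punchIn-injective w _ _
    ; image     = λ u → mk⇔ (λ u∈ → punchOut (to ∈∁⁅⁆ u∈ ∘ sym) , Fin.punchIn-punchOut _)
                            (λ (a , wa≡u) → from ∈∁⁅⁆ (subst (_≢ w) wa≡u (Fin.punchInᵢ≢i w a)))
    ; adjacency = G≡H-w
    }

  card-iso : {G : Graph m} {f : Fin m → Fin (suc m)} → InducedCopy H (∁ ⁅ w ⁆) G f → Iso G (delete H w)
  card-iso {G} {f} fc = Perm.permutation σ τ στ τσ , λ a b →
    trans (adjacency fc a b) (sym (cong₂ (adj H) (punchIn-squeeze f avoids a) (punchIn-squeeze f avoids b)))
    where
    avoids : ∀ a → f a ≢ w
    avoids a = to ∈∁⁅⁆ (into fc a)
    σ : Fin m → Fin m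
    σ = squeeze f avoids
    preimage : ∀ y → ∃ λ a → f a ≡ punchIn w y
    preimage y = to (image fc (punchIn w y)) (from ∈∁⁅⁆ (Fin.punchInᵢ≢i w y))
    τ : Fin m → Fin m
    τ y = proj₁ (preimage y)
    στ : ∀ y → σ (τ y) ≡ y
    στ y = Fin.punchIn-injective w _ _ (trans (punchIn-squeeze f avoids (τ y)) (proj₂ (preimage y)))
    τσ : ∀ a → τ (σ a) ≡ a
    τσ a = injective fc (trans (proj₂ (preimage (σ a))) (punchIn-squeeze f avoids a))

pick : {D : GDD m} {w : Fin (suc m)} → Dec (Any (Selects D w) (candidates m)) → Graph m
pick (yes found) = proj₁ (proj₁ (Any.satisfied found))
pick (no _)      = emptyGraph

deckFromGdd : (m : ℕ) → GDD m → Deck m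
deckFromGdd m D w = pick {D = D} (Any.any? (selects? D w) (candidates m))

pick-card : {H : Graph (suc m)} {w : Fin (suc m)} → 1 ≤ m → Connected (delete H w) →
            (d : Dec (Any (Selects (gdd H) w) (candidates m))) → Iso (pick {D = gdd H} d) (delete H w)
pick-card {H = H} {w} 1≤m _ (yes found) with C , selected ← Any.satisfied found =
  card-iso {H = H} (proj₂ (to (selects-gdd 1≤m H w C) selected))
pick-card {H = H} {w} 1≤m card-connected (no none) with C , C∈ , C≡H-w ← candidates-complete card-connected =
  contradiction (lose C∈ (from (selects-gdd 1≤m H w C) (punchIn w , delete-card {H = H} C≡H-w))) none

mainTheorem9 : Σ ((m : ℕ) → GDD m → Deck m) λ Ψ →
    ∀ (m : ℕ) (H : Graph (suc m)) → TwoConnected H → SameDeck (Ψ m (gdd H)) (deck H)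
mainTheorem9 = deckFromGdd , λ m H (2≤m , _ , cards-connected) →
  Perm.id , λ w → pick-card {H = H} {w} (ℕ.≤-trans (s≤s z≤n) 2≤m) (cards-connected w)
    (Any.any? (selects? (gdd H) w) (candidates m))
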